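{- Let $m,n>1$ and $\alpha\in[0,1]$. The $A_\alpha$-characteristic polynomial of $K_m\circ_1 K_n$ is \begin{multline*} \Phi(A_\alpha(K_m\circ_1 K_n),\lambda)=(\lambda-\alpha m+1)^{m-2}(\lambda-\alpha n+1)^{n-2}\Big((\lambda-m+2-\alpha)(\lambda-n+2-\alpha)(\lambda-\alpha(m+n-2))\\ -(1-\alpha)^2\big((m+n-2)\lambda-(m+n-2)\alpha-(m-1)(n-2)-(m-2)(n-1)\big)\Big). \end{multline*}
   Context: $K_m$ denotes the complete graph on $m$ vertices. $K_m\circ_1 K_n$ is the graph obtained by identifying one vertex of $K_m$ with one vertex of $K_n$. For a graph $G$, $A_\alpha(G)=\alpha D(G)+(1-\alpha)A(G)$, where $D(G)$ is the diagonal degree matrix and $A(G)$ the adjacency matrix, and $\Phi(M,\lambda)=\det(\lambda I-M)$. -}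

module Defs where

open import Level using (Level)
open import Data.Nat using (ℕ; zero; suc; _∸_; _<ᵇ_; _≤ᵇ_; _≡ᵇ_) renaming (_+_ to _+ℕ_)
open import Data.Bool using (Bool; true; false; not; _∧_; _∨_; if_then_else_)
open import Data.Fin using (Fin; toℕ; punchIn) renaming (zero to fzero; suc to fsuc)
open import Algebra.Bundles using (CommutativeRing)

-- A finite simple graph on vertex set Fin N, given by its adjacency relation
-- (a symmetric, irreflexive Bool-valued relation).
Graph : ℕ → Set
Graph N = Fin N → Fin N → Bool

-- K_m ∘₁ K_n on vertex set Fin (m + n ∸ 1):
-- vertices 0 .. m-1 form K_m, vertices m-1 .. m+n-2 form K_n;
-- vertex m-1 is the identified vertex.
KmCircKn : (m n : ℕ) → Graph (m +ℕ n ∸ 1)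
KmCircKn m n i j =
  not (toℕ i ≡ᵇ toℕ j)
  ∧ (((toℕ i <ᵇ m) ∧ (toℕ j <ᵇ m)) ∨ (((m ∸ 1) ≤ᵇ toℕ i) ∧ ((m ∸ 1) ≤ᵇ toℕ j)))

Matrix : ∀ {a} → Set a → ℕ → Set a
Matrix A N = Fin N → Fin N → A

module WithRing {c ℓ : Level} (R : CommutativeRing c ℓ) where
  open CommutativeRing R

  fromℕ : ℕ → Carrier
  fromℕ zero = 0#
  fromℕ (suc k) = 1# + fromℕ k

  _^_ : Carrier → ℕ → Carrier
  x ^ zero = 1#
  x ^ suc k = x * (x ^ k)

  sumFin : ∀ {N} → (Fin N → Carrier) → Carrier
  sumFin {zero} f = 0#
  sumFin {suc N} f = f fzero + sumFin (λ j → f (fsuc j))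

  sign : ℕ → Carrier
  sign zero = 1#
  sign (suc k) = - sign k

  det : ∀ {N} → Matrix Carrier N → Carrier
  det {zero} M = 1#
  det {suc N} M =
    sumFin (λ j → sign (toℕ j) * (M fzero j * det (λ r s → M (fsuc r) (punchIn j s))))

  boolR : Bool → Carrier
  boolR true = 1#
  boolR false = 0#

  adjMat : ∀ {N} → Graph N → Matrix Carrier N
  adjMat G i j = boolR (G i j)

  degree : ∀ {N} → Graph N → Fin N → Carrier
  degree G i = sumFin (λ j → boolR (G i j))

  degMat : ∀ {N} → Graph N → Matrix Carrier N
  degMat G i j = if toℕ i ≡ᵇ toℕ j then degree G i else 0#

  idMat : ∀ {N} → Matrix Carrier N
  idMat i j = if toℕ i ≡ᵇ toℕ j then 1# else 0#

  Aα : ∀ {N} → Graph N → Carrier → Matrix Carrier N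
  Aα G α i j = (α * degMat G i j) + ((1# - α) * adjMat G i j)

  Φ : ∀ {N} → Matrix Carrier N → Carrier → Carrier
  Φ M x = det (λ i j → (x * idMat i j) - M i j)

{-# OPTIONS --safe #-}
-- Order the vertices as the m − 1 private vertices of K_m, the cut vertex, and the n − 1
-- private vertices of K_n. Two private vertices of the same clique are twins: their rows and
-- columns in λI − A_α agree outside their 2×2 block, so subtracting one row from the other and
-- expanding gives D_{k+2} = 2t D_{k+1} − t² D_k for the determinants obtained by peeling off
-- such vertices, with t = λ − αm + 1 (resp. λ − αn + 1), a recurrence with a double root that
-- is solved in closed form. The last private vertex of K_m touches only the cut vertex and is
-- removed by a direct expansion, the cut vertex is a twin-like neighbour of K_n, and what
-- remains is a polynomial identity in λ, α, m and n.
module Submission where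

open import Level using (Level)
open import Algebra.Bundles using (CommutativeRing)
open import Data.Nat as ℕ using (ℕ; zero; suc; _∸_; _≡ᵇ_; _<ᵇ_; _≤ᵇ_; _≤_; _<_; s≤s) renaming (_+_ to _+ℕ_)
import Data.Nat.Properties as ℕ
open import Data.Fin.Properties using (toℕ<n)
open import Data.Bool.Properties using (∧-identityʳ; ∨-identityʳ)
open import Data.Integer as ℤ using (ℤ; +_; -[1+_])
import Data.Integer.Properties as ℤ
open import Data.Sign as Sign using (Sign)
open import Data.Maybe using (Maybe; just; nothing)
open import Relation.Nullary using (yes; no)
open import Relation.Binary.PropositionalEquality as ≡ using (_≡_)
import Algebra.Solver.Ring.AlmostCommutativeRing as ACR
open import Data.Fin as Fin using (Fin; toℕ; punchIn) renaming (zero to fzero; suc to fsuc)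
open import Data.Vec.Functional using (_∷_; tail)
open import Function using (_∘_)
open import Data.Bool using (Bool; true; false; if_then_else_; not; _∧_; _∨_)
open import Defs

module IntegerCoefficientSolver {c ℓ} (R : CommutativeRing c ℓ) where
  open CommutativeRing R
  open WithRing R using (fromℕ)
  open import Algebra.Properties.Ring ring using (-0#≈0#; -‿involutive; -‿+-comm; -1*x≈-x)
  open import Algebra.Properties.CommutativeSemigroup +-commutativeSemigroup using () renaming (interchange to +-interchange)
  open import Algebra.Properties.CommutativeSemigroup *-commutativeSemigroup using () renaming (interchange to *-interchange)
  open import Relation.Binary.Reasoning.Setoid setoid

  fromℕ-+ : ∀ m n → fromℕ (m +ℕ n) ≈ fromℕ m + fromℕ n
  fromℕ-+ zero n = sym (+-identityˡ _)
  fromℕ-+ (suc m) n = trans (+-congˡ (fromℕ-+ m n)) (sym (+-assoc _ _ _))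

  fromℕ-* : ∀ m n → fromℕ (m ℕ.* n) ≈ fromℕ m * fromℕ n
  fromℕ-* zero n = sym (zeroˡ _)
  fromℕ-* (suc m) n = begin
    fromℕ (n +ℕ m ℕ.* n)          ≈⟨ fromℕ-+ n (m ℕ.* n) ⟩
    fromℕ n + fromℕ (m ℕ.* n)      ≈⟨ +-cong (sym (*-identityˡ _)) (fromℕ-* m n) ⟩
    1# * fromℕ n + fromℕ m * fromℕ n ≈⟨ sym (distribʳ _ _ _) ⟩
    (1# + fromℕ m) * fromℕ n        ∎

  fromℤ : ℤ → Carrier
  fromℤ (+ n)    = fromℕ n
  fromℤ -[1+ n ] = - fromℕ (suc n)

  fromℤ-⊖ : ∀ m n → fromℤ (m ℤ.⊖ n) ≈ fromℕ m - fromℕ n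
  fromℤ-⊖ m zero = sym (trans (+-congˡ -0#≈0#) (+-identityʳ _))
  fromℤ-⊖ zero (suc n) = sym (+-identityˡ _)
  fromℤ-⊖ (suc m) (suc n) = begin
    fromℤ (suc m ℤ.⊖ suc n)              ≡⟨ ≡.cong fromℤ (ℤ.[1+m]⊖[1+n]≡m⊖n m n) ⟩
    fromℤ (m ℤ.⊖ n)                      ≈⟨ fromℤ-⊖ m n ⟩
    fromℕ m - fromℕ n                    ≈⟨ sym (+-identityˡ _) ⟩
    0# + (fromℕ m - fromℕ n)             ≈⟨ +-congʳ (sym (-‿inverseʳ 1#)) ⟩
    (1# - 1#) + (fromℕ m - fromℕ n)      ≈⟨ +-interchange 1# (- 1#) (fromℕ m) (- fromℕ n) ⟩
    (1# + fromℕ m) + (- 1# - fromℕ n)    ≈⟨ +-congˡ (-‿+-comm 1# (fromℕ n)) ⟩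
    fromℕ (suc m) - fromℕ (suc n)        ∎

  fromℤ-+ : ∀ i j → fromℤ (i ℤ.+ j) ≈ fromℤ i + fromℤ j
  fromℤ-+ (+ m)    (+ n)    = fromℕ-+ m n
  fromℤ-+ (+ m)    -[1+ n ] = fromℤ-⊖ m (suc n)
  fromℤ-+ -[1+ m ] (+ n)    = trans (fromℤ-⊖ n (suc m)) (+-comm _ _)
  fromℤ-+ -[1+ m ] -[1+ n ] = begin
    - fromℕ (suc (suc (m +ℕ n)))       ≡⟨ ≡.cong (λ k → - fromℕ (suc k)) (ℕ.+-suc m n) ⟨
    - fromℕ (suc m +ℕ suc n)           ≈⟨ -‿cong (fromℕ-+ (suc m) (suc n)) ⟩
    - (fromℕ (suc m) + fromℕ (suc n))   ≈⟨ -‿+-comm _ _ ⟨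
    - fromℕ (suc m) - fromℕ (suc n)     ∎

  fromℤ-neg : ∀ i → fromℤ (ℤ.- i) ≈ - fromℤ i
  fromℤ-neg (+ zero)  = sym -0#≈0#
  fromℤ-neg (+ suc n) = refl
  fromℤ-neg -[1+ n ]  = sym (-‿involutive _)

  fromSign : Sign → Carrier
  fromSign Sign.+ = 1#
  fromSign Sign.- = - 1#

  fromSign-* : ∀ s t → fromSign (s Sign.* t) ≈ fromSign s * fromSign t
  fromSign-* Sign.+ t      = sym (*-identityˡ _)
  fromSign-* Sign.- Sign.+ = sym (*-identityʳ _)
  fromSign-* Sign.- Sign.- = sym (trans (-1*x≈-x _) (-‿involutive _))

  fromℤ-◃ : ∀ s n → fromℤ (s ℤ.◃ n) ≈ fromSign s * fromℕ n
  fromℤ-◃ s      zero    = sym (zeroʳ _)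
  fromℤ-◃ Sign.+ (suc n) = sym (*-identityˡ _)
  fromℤ-◃ Sign.- (suc n) = sym (-1*x≈-x _)

  fromℤ-signAbs : ∀ i → fromℤ i ≈ fromSign (ℤ.sign i) * fromℕ ℤ.∣ i ∣
  fromℤ-signAbs (+ n)    = sym (*-identityˡ _)
  fromℤ-signAbs -[1+ n ] = sym (-1*x≈-x _)

  fromℤ-* : ∀ i j → fromℤ (i ℤ.* j) ≈ fromℤ i * fromℤ j
  fromℤ-* i j = begin
    fromℤ (i ℤ.* j)                                        ≈⟨ fromℤ-◃ (ℤ.sign i Sign.* ℤ.sign j) (ℤ.∣ i ∣ ℕ.* ℤ.∣ j ∣) ⟩
    fromSign (si Sign.* sj) * fromℕ (ℤ.∣ i ∣ ℕ.* ℤ.∣ j ∣)  ≈⟨ *-cong (fromSign-* si sj) (fromℕ-* ℤ.∣ i ∣ ℤ.∣ j ∣) ⟩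
    (fromSign si * fromSign sj) * (fromℕ ℤ.∣ i ∣ * fromℕ ℤ.∣ j ∣) ≈⟨ *-interchange _ _ _ _ ⟩
    (fromSign si * fromℕ ℤ.∣ i ∣) * (fromSign sj * fromℕ ℤ.∣ j ∣) ≈⟨ *-cong (fromℤ-signAbs i) (fromℤ-signAbs j) ⟨
    fromℤ i * fromℤ j                                      ∎
    where si = ℤ.sign i; sj = ℤ.sign j

  -- Solver constants must evaluate to literally 0#, 1#, 1# + 1#, … for refl to match the goals,
  -- whereas fromℕ 1 is 1# + 0#.
  numeral : ℕ → Carrier
  numeral zero          = 0#
  numeral (suc zero)    = 1#
  numeral (suc (suc n)) = 1# + numeral (suc n)

  numeral≈fromℕ : ∀ n → numeral n ≈ fromℕ n
  numeral≈fromℕ zero          = refl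
  numeral≈fromℕ (suc zero)    = sym (+-identityʳ _)
  numeral≈fromℕ (suc (suc n)) = +-congˡ (numeral≈fromℕ (suc n))

  ⟦_⟧ℤ : ℤ → Carrier
  ⟦ + n ⟧ℤ    = numeral n
  ⟦ -[1+ n ] ⟧ℤ = - numeral (suc n)

  ⟦⟧ℤ≈fromℤ : ∀ i → ⟦ i ⟧ℤ ≈ fromℤ i
  ⟦⟧ℤ≈fromℤ (+ n)    = numeral≈fromℕ n
  ⟦⟧ℤ≈fromℤ -[1+ n ] = -‿cong (numeral≈fromℕ (suc n))

  homomorphism : ℤ.+-*-rawRing ACR.-Raw-AlmostCommutative⟶ ACR.fromCommutativeRing R
  homomorphism = record
    { ⟦_⟧    = ⟦_⟧ℤ
    ; +-homo = λ i j → trans (⟦⟧ℤ≈fromℤ (i ℤ.+ j)) (trans (fromℤ-+ i j) (+-cong (back i) (back j)))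
    ; *-homo = λ i j → trans (⟦⟧ℤ≈fromℤ (i ℤ.* j)) (trans (fromℤ-* i j) (*-cong (back i) (back j)))
    ; -‿homo = λ i → trans (⟦⟧ℤ≈fromℤ (ℤ.- i)) (trans (fromℤ-neg i) (-‿cong (back i)))
    ; 0-homo = refl
    ; 1-homo = refl
    }
    where
    back : ∀ i → fromℤ i ≈ ⟦ i ⟧ℤ
    back i = sym (⟦⟧ℤ≈fromℤ i)

  _≟ℤ_ : ∀ i j → Maybe (⟦ i ⟧ℤ ≈ ⟦ j ⟧ℤ)
  i ≟ℤ j with i ℤ.≟ j
  ... | yes ≡.refl = just refl
  ... | no _       = nothing

  open import Algebra.Solver.Ring ℤ.+-*-rawRing (ACR.fromCommutativeRing R) homomorphism _≟ℤ_ public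


module DeterminantProperties {c ℓ} (R : CommutativeRing c ℓ) where
  open CommutativeRing R
  open WithRing R
  open IntegerCoefficientSolver R using (solve; _:=_; _:+_; _:*_; :-_; _:-_; con)
  open import Algebra.Properties.Ring ring using (-0#≈0#; -‿+-comm)
  open import Relation.Binary.Reasoning.Setoid setoid

  sumFin-cong : ∀ {N} {f g : Fin N → Carrier} → (∀ j → f j ≈ g j) → sumFin f ≈ sumFin g
  sumFin-cong {zero}  f≈g = refl
  sumFin-cong {suc N} f≈g = +-cong (f≈g fzero) (sumFin-cong (f≈g ∘ fsuc))

  sumFin-zero : ∀ {N} {f : Fin N → Carrier} → (∀ j → f j ≈ 0#) → sumFin f ≈ 0#
  sumFin-zero {zero}  f≈0 = refl
  sumFin-zero {suc N} f≈0 = trans (+-cong (f≈0 fzero) (sumFin-zero (f≈0 ∘ fsuc))) (+-identityˡ 0#)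

  sumFin-+ : ∀ {N} (f g : Fin N → Carrier) → sumFin (λ j → f j + g j) ≈ sumFin f + sumFin g
  sumFin-+ {zero}  f g = sym (+-identityˡ 0#)
  sumFin-+ {suc N} f g = trans (+-congˡ (sumFin-+ (f ∘ fsuc) (g ∘ fsuc)))
    (solve 4 (λ a b c d → (a :+ b) :+ (c :+ d) := (a :+ c) :+ (b :+ d)) refl (f fzero) (g fzero) _ _)

  sumFin-*ˡ : ∀ {N} k (f : Fin N → Carrier) → sumFin (λ j → k * f j) ≈ k * sumFin f
  sumFin-*ˡ {zero}  k f = sym (zeroʳ k)
  sumFin-*ˡ {suc N} k f = trans (+-congˡ (sumFin-*ˡ k (f ∘ fsuc))) (sym (distribˡ k _ _))

  sumFin-neg : ∀ {N} (f : Fin N → Carrier) → sumFin (λ j → - f j) ≈ - sumFin f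
  sumFin-neg {zero}  f = sym -0#≈0#
  sumFin-neg {suc N} f = trans (+-congˡ (sumFin-neg (f ∘ fsuc))) (-‿+-comm _ _)

  sumFin-const-1# : ∀ N → sumFin {N} (λ _ → 1#) ≈ fromℕ N
  sumFin-const-1# zero    = refl
  sumFin-const-1# (suc N) = +-congˡ (sumFin-const-1# N)

  det-cong : ∀ {N} {M M′ : Matrix Carrier N} → (∀ i j → M i j ≈ M′ i j) → det M ≈ det M′
  det-cong {zero}  M≈M′ = refl
  det-cong {suc N} M≈M′ = sumFin-cong λ j →
    *-congˡ {sign (toℕ j)} (*-cong (M≈M′ fzero j) (det-cong λ r s → M≈M′ (fsuc r) (punchIn j s)))

  -- det (v ∷ X) unfolds to rowExpansion v (λ h → det (λ r s → X r (h s))), so det (v ∷ v ∷ X) is a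
  -- twoRowExpansion. Its terms in which one of the two rows uses column 0 cancel in pairs; the
  -- rest (twoRowRemainder) is the same expansion for the rows with column 0 deleted.
  rowExpansion : ∀ {N} → (Fin (suc N) → Carrier) → ((Fin N → Fin (suc N)) → Carrier) → Carrier
  rowExpansion v Q = sumFin λ j → sign (toℕ j) * (v j * Q (punchIn j))

  twoRowExpansion : ∀ {N} → (Fin (suc (suc N)) → Carrier) → ((Fin N → Fin (suc (suc N))) → Carrier) → Carrier
  twoRowExpansion v Q = rowExpansion v λ h → rowExpansion (v ∘ h) λ g → Q (h ∘ g)

  twoRowRemainder : ∀ {N} → (Fin (suc (suc N)) → Carrier) → ((Fin N → Fin (suc (suc N))) → Carrier) → Carrier
  twoRowRemainder v Q = sumFin λ j → - sign (toℕ j) * (v (fsuc j) *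
    sumFin λ k → - sign (toℕ k) * (v (fsuc (punchIn j k)) * Q (punchIn (fsuc j) ∘ punchIn (fsuc k))))

  Extensional : ∀ {N K} → ((Fin N → Fin K) → Carrier) → Set ℓ
  Extensional Q = ∀ {h h′} → (∀ s → h s ≡ h′ s) → Q h ≈ Q h′

  twoRowExpansion≈twoRowRemainder : ∀ {N} v (Q : (Fin N → Fin (suc (suc N))) → Carrier) →
    twoRowExpansion v Q ≈ twoRowRemainder v Q
  twoRowExpansion≈twoRowRemainder v Q = begin
    1# * (v₀ * A) + sumFin (λ j → - sign (toℕ j) * (v (fsuc j) * (1# * (v₀ * q j) + C j)))
      ≈⟨ +-congˡ (sumFin-cong λ j → solve 5 (λ s w a q c →
           (:- s) :* (w :* (con (+ 1) :* (a :* q) :+ c)) := (:- a) :* (s :* (w :* q)) :+ (:- s) :* (w :* c))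
           refl (sign (toℕ j)) (v (fsuc j)) v₀ (q j) (C j)) ⟩
    1# * (v₀ * A) + sumFin (λ j → - v₀ * a j + Y j)
      ≈⟨ +-congˡ (trans (sumFin-+ (λ j → - v₀ * a j) Y) (+-congʳ (sumFin-*ˡ (- v₀) a))) ⟩
    1# * (v₀ * A) + (- v₀ * A + sumFin Y)
      ≈⟨ solve 3 (λ a b y → con (+ 1) :* (a :* b) :+ ((:- a) :* b :+ y) := y) refl v₀ A (sumFin Y) ⟩
    sumFin Y ∎
    where
    v₀ = v fzero
    q : Fin _ → Carrier
    q j = Q (fsuc ∘ punchIn j)
    a : Fin _ → Carrier
    a j = sign (toℕ j) * (v (fsuc j) * q j)
    A = sumFin a
    C : Fin _ → Carrier
    C j = sumFin λ k → - sign (toℕ k) * (v (fsuc (punchIn j k)) * Q (punchIn (fsuc j) ∘ punchIn (fsuc k)))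
    Y : Fin _ → Carrier
    Y j = - sign (toℕ j) * (v (fsuc j) * C j)

  twoRowRemainder-zero : ∀ v (Q : (Fin 0 → Fin 2) → Carrier) → twoRowRemainder v Q ≈ 0#
  twoRowRemainder-zero v Q = sumFin-zero λ j →
    solve 2 (λ s w → (:- s) :* (w :* con (+ 0)) := con (+ 0)) refl (sign (toℕ j)) (v (fsuc j))

  punchIn-suc-punchIn-suc : ∀ {N} (j : Fin (suc (suc N))) (k : Fin (suc N)) s →
    punchIn (fsuc j) (punchIn (fsuc k) s) ≡ Fin.lift 1 (punchIn j ∘ punchIn k) s
  punchIn-suc-punchIn-suc j k fzero    = ≡.refl
  punchIn-suc-punchIn-suc j k (fsuc s) = ≡.refl

  twoRowRemainder-suc : ∀ {N} v (Q : (Fin (suc N) → Fin (3 +ℕ N)) → Carrier) → Extensional Q →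
    twoRowRemainder v Q ≈ twoRowExpansion (tail v) (Q ∘ Fin.lift 1)
  twoRowRemainder-suc v Q ext = sumFin-cong λ j → begin
    - sign (toℕ j) * (v (fsuc j) * _)                        ≈⟨ *-congˡ (*-congˡ (sumFin-cong (shift j))) ⟩
    - sign (toℕ j) * (v (fsuc j) * sumFin (λ k → - inner j k)) ≈⟨ *-congˡ (*-congˡ (sumFin-neg (inner j))) ⟩
    - sign (toℕ j) * (v (fsuc j) * - sumFin (inner j))       ≈⟨ solve 3 (λ s w c → (:- s) :* (w :* (:- c)) := s :* (w :* c)) refl _ _ _ ⟩
    sign (toℕ j) * (v (fsuc j) * sumFin (inner j))           ∎
    where
    inner : ∀ j → Fin _ → Carrier
    inner j k = sign (toℕ k) * (v (fsuc (punchIn j k)) * Q (Fin.lift 1 (punchIn j ∘ punchIn k)))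
    shift : ∀ j k → - sign (toℕ k) * (v (fsuc (punchIn j k)) * Q (punchIn (fsuc j) ∘ punchIn (fsuc k))) ≈ - inner j k
    shift j k = trans (*-congˡ (*-congˡ (ext (punchIn-suc-punchIn-suc j k))))
      (solve 3 (λ s w q → (:- s) :* (w :* q) := :- (s :* (w :* q))) refl _ _ _)

  twoRowExpansion-vanishes : ∀ N v (Q : (Fin N → Fin (suc (suc N))) → Carrier) → Extensional Q →
    twoRowExpansion v Q ≈ 0#
  twoRowExpansion-vanishes zero    v Q ext = trans (twoRowExpansion≈twoRowRemainder v Q) (twoRowRemainder-zero v Q)
  twoRowExpansion-vanishes (suc N) v Q ext = begin
    twoRowExpansion v Q                     ≈⟨ twoRowExpansion≈twoRowRemainder v Q ⟩
    twoRowRemainder v Q                     ≈⟨ twoRowRemainder-suc v Q ext ⟩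
    twoRowExpansion (tail v) (Q ∘ Fin.lift 1) ≈⟨ twoRowExpansion-vanishes N (tail v) (Q ∘ Fin.lift 1) (ext ∘ lift-cong) ⟩
    0#                                      ∎
    where
    lift-cong : ∀ {h h′ : Fin N → Fin _} → (∀ s → h s ≡ h′ s) → ∀ s → Fin.lift 1 h s ≡ Fin.lift 1 h′ s
    lift-cong h≗h′ fzero    = ≡.refl
    lift-cong h≗h′ (fsuc s) = ≡.cong fsuc (h≗h′ s)

  det-duplicateRow : ∀ {N} (v : Fin (suc (suc N)) → Carrier) X → det (v ∷ v ∷ X) ≈ 0#
  det-duplicateRow {N} v X = twoRowExpansion-vanishes N v (λ h → det λ r s → X r (h s))
    (λ h≗h′ → det-cong λ r s → reflexive (≡.cong (X r) (h≗h′ s)))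

  det-linearˡ : ∀ {N} (u u₁ u₂ : Fin (suc N) → Carrier) k X → (∀ j → u j ≈ u₁ j + k * u₂ j) →
    det (u ∷ X) ≈ det (u₁ ∷ X) + k * det (u₂ ∷ X)
  det-linearˡ u u₁ u₂ k X u≈ = begin
    sumFin (λ j → sign (toℕ j) * (u j * D j))
      ≈⟨ sumFin-cong (λ j → trans (*-congˡ (*-congʳ (u≈ j)))
           (solve 5 (λ s a b k d → s :* ((a :+ k :* b) :* d) := s :* (a :* d) :+ k :* (s :* (b :* d)))
             refl (sign (toℕ j)) (u₁ j) (u₂ j) k (D j))) ⟩
    sumFin (λ j → t₁ j + k * t₂ j)      ≈⟨ trans (sumFin-+ t₁ (λ j → k * t₂ j)) (+-congˡ (sumFin-*ˡ k t₂)) ⟩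
    sumFin t₁ + k * sumFin t₂          ∎
    where
    D : Fin _ → Carrier
    D j = det λ r s → X r (punchIn j s)
    t₁ t₂ : Fin _ → Carrier
    t₁ j = sign (toℕ j) * (u₁ j * D j)
    t₂ j = sign (toℕ j) * (u₂ j * D j)

  det-sparse₂ : ∀ {N} (u : Fin (suc (suc N)) → Carrier) X → (∀ j → u (fsuc (fsuc j)) ≈ 0#) →
    det (u ∷ X) ≈ u fzero * det (λ r s → X r (fsuc s)) - u (fsuc fzero) * det (λ r s → X r (punchIn (fsuc fzero) s))
  det-sparse₂ u X u≈0 = trans (+-congˡ (+-congˡ (sumFin-zero λ j → trans (*-congˡ (*-congʳ (u≈0 j)))
      (solve 2 (λ s d → s :* (con (+ 0) :* d) := con (+ 0)) refl _ _))))
    (solve 4 (λ a d b e → con (+ 1) :* (a :* d) :+ ((:- con (+ 1)) :* (b :* e) :+ con (+ 0)) := a :* d :- b :* e) refl _ _ _ _)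

  det-zeroColumn : ∀ {N} (M : Matrix Carrier (suc N)) → (∀ i → M i fzero ≈ 0#) → det M ≈ 0#
  det-zeroColumn {zero} M M≈0 = trans (+-identityʳ _) (trans (*-congˡ (*-congʳ (M≈0 fzero)))
    (solve 2 (λ s d → s :* (con (+ 0) :* d) := con (+ 0)) refl _ _))
  det-zeroColumn {suc N} M M≈0 = sumFin-zero term≈0
    where
    term≈0 : ∀ j → sign (toℕ j) * (M fzero j * det (λ r s → M (fsuc r) (punchIn j s))) ≈ 0#
    term≈0 fzero    = trans (*-congˡ (*-congʳ (M≈0 fzero)))
      (solve 2 (λ s d → s :* (con (+ 0) :* d) := con (+ 0)) refl _ _)
    term≈0 (fsuc j) = trans (*-congˡ (*-congˡ (det-zeroColumn (λ r s → M (fsuc r) (punchIn (fsuc j) s)) (M≈0 ∘ fsuc))))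
      (solve 2 (λ s a → s :* (a :* con (+ 0)) := con (+ 0)) refl _ _)

  e₀ : ∀ {K} → Fin (suc K) → Carrier
  e₀ fzero    = 1#
  e₀ (fsuc _) = 0#

  det-+e₀ˡ : ∀ {N} (u w : Fin (suc N) → Carrier) k X → (∀ s → u s ≈ w s + k * e₀ s) →
    det (u ∷ X) ≈ det (w ∷ X) + k * det (λ r s → X r (fsuc s))
  det-+e₀ˡ u w k X u≈ = trans (det-linearˡ u w e₀ k X u≈) (+-congˡ (*-congˡ e₀-row))
    where
    e₀-row : det (e₀ ∷ X) ≈ det (λ r s → X r (fsuc s))
    e₀-row = trans (+-congˡ (sumFin-zero {f = λ j → - sign (toℕ j) * (0# * det λ r s → X r (punchIn (fsuc j) s))}
                                       λ j → solve 2 (λ s d → s :* (con (+ 0) :* d) := con (+ 0)) refl _ _))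
      (solve 1 (λ d → con (+ 1) :* (con (+ 1) :* d) :+ con (+ 0) := d) refl _)

  minor : ∀ {N} → Matrix Carrier (suc N) → Matrix Carrier N
  minor M r s = M (fsuc r) (fsuc s)

  -- Subtract row 1 from row 0, which leaves a row supported on columns 0 and 1; in the minor
  -- without column 1, the first row differs from that of minor M only in its first entry.
  det-twin : ∀ {N} (M : Matrix Carrier (suc (suc N))) →
    (∀ i → M (fsuc (fsuc i)) fzero ≈ M (fsuc (fsuc i)) (fsuc fzero)) →
    (∀ j → M fzero (fsuc (fsuc j)) ≈ M (fsuc fzero) (fsuc (fsuc j))) →
    det M ≈ (M fzero fzero - M (fsuc fzero) fzero) * det (minor M)
            - (M fzero (fsuc fzero) - M (fsuc fzero) (fsuc fzero))
              * (det (minor M) + (M (fsuc fzero) fzero - M (fsuc fzero) (fsuc fzero)) * det (minor (minor M)))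
  det-twin {N} M columns≈ rows≈ = begin
    det (M₀ ∷ X)
      ≈⟨ det-linearˡ M₀ d M₁ 1# X (λ j → solve 2 (λ a b → a := (a :- b) :+ con (+ 1) :* b) refl (M₀ j) (M₁ j)) ⟩
    det (d ∷ X) + 1# * det (M₁ ∷ M₁ ∷ tail X)
      ≈⟨ +-congˡ (trans (*-congˡ (det-duplicateRow M₁ (tail X))) (zeroʳ 1#)) ⟩
    det (d ∷ X) + 0#
      ≈⟨ +-identityʳ _ ⟩
    det (d ∷ X)
      ≈⟨ det-sparse₂ d X (λ j → trans (+-congʳ (rows≈ j)) (-‿inverseʳ _)) ⟩
    d fzero * det (minor M) - d (fsuc fzero) * det (λ r s → X r (punchIn (fsuc fzero) s))
      ≈⟨ +-congˡ (-‿cong (*-congˡ dropColumn₁)) ⟩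
    d fzero * det (minor M) - d (fsuc fzero) * (det (minor M) + k * det (minor (minor M))) ∎
    where
    M₀ M₁ d : Fin (suc (suc N)) → Carrier
    M₀ = M fzero
    M₁ = M (fsuc fzero)
    d j = M₀ j - M₁ j
    X = tail M
    k = M₁ fzero - M₁ (fsuc fzero)
    dropColumn₁ : det (λ r s → X r (punchIn (fsuc fzero) s)) ≈ det (minor M) + k * det (minor (minor M))
    dropColumn₁ = trans (det-+e₀ˡ (M₁ ∘ punchIn (fsuc fzero)) (tail M₁) k Y split) (+-congʳ (det-cong agree))
      where
      Y : Fin N → Fin (suc N) → Carrier
      Y r s = X (fsuc r) (punchIn (fsuc fzero) s)
      agree : ∀ r s → (tail M₁ ∷ Y) r s ≈ minor M r s
      agree fzero    s        = refl
      agree (fsuc r) fzero    = columns≈ r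
      agree (fsuc r) (fsuc s) = refl
      split : ∀ s → M₁ (punchIn (fsuc fzero) s) ≈ M₁ (fsuc s) + k * e₀ s
      split fzero    = solve 2 (λ a b → a := b :+ (a :- b) :* con (+ 1)) refl _ _
      split (fsuc s) = solve 2 (λ a b → a := a :+ b :* con (+ 0)) refl _ _

  det-sparseFirstRowColumn : ∀ {N} (M : Matrix Carrier (suc (suc N))) →
    (∀ j → M fzero (fsuc (fsuc j)) ≈ 0#) → (∀ i → M (fsuc (fsuc i)) fzero ≈ 0#) →
    det M ≈ M fzero fzero * det (minor M) - M fzero (fsuc fzero) * (M (fsuc fzero) fzero * det (minor (minor M)))
  det-sparseFirstRowColumn {N} M row≈0 column≈0 = begin
    det (M fzero ∷ X)
      ≈⟨ det-sparse₂ (M fzero) X row≈0 ⟩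
    M fzero fzero * det (minor M) - M fzero (fsuc fzero) * det (λ r s → X r (punchIn (fsuc fzero) s))
      ≈⟨ +-congˡ (-‿cong (*-congˡ dropColumn₁)) ⟩
    M fzero fzero * det (minor M) - M fzero (fsuc fzero) * (k * det (minor (minor M))) ∎
    where
    X = tail M
    k = M (fsuc fzero) fzero
    w : Fin (suc N) → Carrier
    w fzero    = 0#
    w (fsuc s) = M (fsuc fzero) (fsuc (fsuc s))
    Y : Fin N → Fin (suc N) → Carrier
    Y r s = X (fsuc r) (punchIn (fsuc fzero) s)
    u : Fin (suc N) → Carrier
    u s = M (fsuc fzero) (punchIn (fsuc fzero) s)
    split : ∀ s → u s ≈ w s + k * e₀ s
    split fzero    = solve 1 (λ a → a := con (+ 0) :+ a :* con (+ 1)) refl _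
    split (fsuc s) = solve 2 (λ a b → a := a :+ b :* con (+ 0)) refl _ _
    firstColumn≈0 : ∀ i → (w ∷ Y) i fzero ≈ 0#
    firstColumn≈0 fzero    = refl
    firstColumn≈0 (fsuc r) = column≈0 r
    dropColumn₁ : det (λ r s → X r (punchIn (fsuc fzero) s)) ≈ k * det (minor (minor M))
    dropColumn₁ = begin
      det (u ∷ Y)                                 ≈⟨ det-+e₀ˡ u w k Y split ⟩
      det (w ∷ Y) + k * det (minor (minor M))     ≈⟨ +-congʳ (det-zeroColumn (w ∷ Y) firstColumn≈0) ⟩
      0# + k * det (minor (minor M))              ≈⟨ +-identityˡ _ ⟩
      k * det (minor (minor M))                   ∎

module RepeatedRoot {c ℓ} (R : CommutativeRing c ℓ) where
  open CommutativeRing R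
  open WithRing R
  open IntegerCoefficientSolver R using (solve; _:=_; _:+_; _:*_; _:-_; con)
  open import Relation.Binary.Reasoning.Setoid setoid

  repeatedRoot-recurrence : ∀ (D : ℕ → Carrier) t → (∀ n → D (2 +ℕ n) ≈ (t + t) * D (suc n) - (t * t) * D n) →
    ∀ n → D (suc n) ≈ t ^ n * (fromℕ (suc n) * D 1 - (fromℕ n * t) * D 0)
  repeatedRoot-recurrence D t step zero = solve 3 (λ d₁ d₀ t →
      d₁ := con (+ 1) :* ((con (+ 1) :+ con (+ 0)) :* d₁ :- (con (+ 0) :* t) :* d₀)) refl (D 1) (D 0) t
  repeatedRoot-recurrence D t step (suc zero) = trans (step 0) (solve 3 (λ d₁ d₀ t →
      (t :+ t) :* d₁ :- (t :* t) :* d₀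
        := t :* con (+ 1) :* ((con (+ 1) :+ (con (+ 1) :+ con (+ 0))) :* d₁ :- ((con (+ 1) :+ con (+ 0)) :* t) :* d₀))
      refl (D 1) (D 0) t)
  repeatedRoot-recurrence D t step (suc (suc n)) = begin
    D (3 +ℕ n)                                                      ≈⟨ step (suc n) ⟩
    (t + t) * D (2 +ℕ n) - (t * t) * D (suc n)                      ≈⟨ +-cong (*-congˡ (repeatedRoot-recurrence D t step (suc n)))
                                                                          (-‿cong (*-congˡ (repeatedRoot-recurrence D t step n))) ⟩
    (t + t) * (t * t ^ n * (fromℕ (2 +ℕ n) * D 1 - (fromℕ (suc n) * t) * D 0))
      - (t * t) * (t ^ n * (fromℕ (suc n) * D 1 - (fromℕ n * t) * D 0)) ≈⟨ solve 5 (λ t P F d₁ d₀ →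
          (t :+ t) :* (t :* P :* ((con (+ 1) :+ (con (+ 1) :+ F)) :* d₁ :- ((con (+ 1) :+ F) :* t) :* d₀))
            :- (t :* t) :* (P :* ((con (+ 1) :+ F) :* d₁ :- (F :* t) :* d₀))
          := t :* (t :* P) :* ((con (+ 1) :+ (con (+ 1) :+ (con (+ 1) :+ F))) :* d₁ :- ((con (+ 1) :+ (con (+ 1) :+ F)) :* t) :* d₀))
          refl t (t ^ n) (fromℕ n) (D 1) (D 0) ⟩
    t ^ (2 +ℕ n) * (fromℕ (3 +ℕ n) * D 1 - (fromℕ (2 +ℕ n) * t) * D 0) ∎

data Side : Set where
  left cut right : Side

inFirst inSecond : Side → Bool
inFirst  left  = true
inFirst  cut   = true
inFirst  right = false
inSecond left  = false
inSecond cut   = true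
inSecond right = true

adjacentSides : Side → Side → Bool
adjacentSides s t = (inFirst s ∧ inFirst t) ∨ (inSecond s ∧ inSecond t)

-- The side of vertex i when the p private vertices of K_m come first, then the cut vertex,
-- then the private vertices of K_n (the order of Defs.KmCircKn).
side : ℕ → ℕ → Side
side zero    zero    = cut
side zero    (suc _) = right
side (suc p) zero    = left
side (suc p) (suc i) = side p i

module SideMatrix {c ℓ} (R : CommutativeRing c ℓ) (a b d e : CommutativeRing.Carrier R) where
  open CommutativeRing R
  open WithRing R
  open IntegerCoefficientSolver R using (solve; _:=_; _:+_; _:*_; _:-_; con)
  open DeterminantProperties R using (det-twin; det-sparseFirstRowColumn)
  open RepeatedRoot R using (repeatedRoot-recurrence)
  open import Relation.Binary.Reasoning.Setoid setoid

  diagonal : Side → Carrier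
  diagonal left  = a + e
  diagonal cut   = d
  diagonal right = b + e

  entry : ℕ → ℕ → ℕ → Carrier
  entry p i j = if i ≡ᵇ j then diagonal (side p i) else (if adjacentSides (side p i) (side p j) then e else 0#)

  sideMatrix : ∀ p q → Matrix Carrier (p +ℕ suc q)
  sideMatrix p q i j = entry p (toℕ i) (toℕ j)

  uniform : ∀ N → Matrix Carrier N
  uniform N i j = if toℕ i ≡ᵇ toℕ j then b + e else e

  det-uniform : ∀ n → det (uniform (suc n)) ≈ b ^ n * (b + fromℕ (suc n) * e)
  det-uniform n = begin
    det (uniform (suc n))                            ≈⟨ repeatedRoot-recurrence (det ∘ uniform) b step n ⟩
    b ^ n * (fromℕ (suc n) * det (uniform 1) - (fromℕ n * b) * 1#) ≈⟨ *-congˡ (solve 3 (λ b e F →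
        (con (+ 1) :+ F) :* (con (+ 1) :* ((b :+ e) :* con (+ 1)) :+ con (+ 0)) :- (F :* b) :* con (+ 1)
        := b :+ (con (+ 1) :+ F) :* e) refl b e (fromℕ n)) ⟩
    b ^ n * (b + fromℕ (suc n) * e)                  ∎
    where
    step : ∀ n → det (uniform (2 +ℕ n)) ≈ (b + b) * det (uniform (suc n)) - (b * b) * det (uniform n)
    step n = trans (det-twin (uniform (2 +ℕ n)) (λ _ → refl) (λ _ → refl))
      (solve 4 (λ b e d₁ d₀ → ((b :+ e) :- e) :* d₁ :- (e :- (b :+ e)) :* (d₁ :+ (e :- (b :+ e)) :* d₀)
                              := (b :+ b) :* d₁ :- (b :* b) :* d₀) refl b e _ _)

  det-cutThenRight : ∀ q → det (sideMatrix 0 (suc q)) ≈ b ^ q * (d * (b + fromℕ (suc q) * e) - fromℕ (suc q) * (e * e))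
  det-cutThenRight q = trans (det-twin (sideMatrix 0 (suc q)) (λ _ → refl) (λ _ → refl)) (afterTwin q)
    where
    afterTwin : ∀ q → (d - e) * det (uniform (suc q)) - (e - (b + e)) * (det (uniform (suc q)) + (e - (b + e)) * det (uniform q))
                       ≈ b ^ q * (d * (b + fromℕ (suc q) * e) - fromℕ (suc q) * (e * e))
    afterTwin zero = begin
      _ ≈⟨ +-cong (*-congˡ (det-uniform 0)) (-‿cong (*-congˡ (+-congʳ (det-uniform 0)))) ⟩
      (d - e) * (1# * (b + (1# + 0#) * e)) - (e - (b + e)) * (1# * (b + (1# + 0#) * e) + (e - (b + e)) * 1#)
        ≈⟨ solve 3 (λ b d e →
             (d :- e) :* (con (+ 1) :* (b :+ (con (+ 1) :+ con (+ 0)) :* e))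
               :- (e :- (b :+ e)) :* (con (+ 1) :* (b :+ (con (+ 1) :+ con (+ 0)) :* e) :+ (e :- (b :+ e)) :* con (+ 1))
             := con (+ 1) :* (d :* (b :+ (con (+ 1) :+ con (+ 0)) :* e) :- (con (+ 1) :+ con (+ 0)) :* (e :* e)))
           refl b d e ⟩
      _ ∎
    afterTwin (suc q) = begin
      _ ≈⟨ +-cong (*-congˡ (det-uniform (suc q))) (-‿cong (*-congˡ (+-cong (det-uniform (suc q)) (*-congˡ (det-uniform q))))) ⟩
      (d - e) * (b * b ^ q * (b + fromℕ (2 +ℕ q) * e))
        - (e - (b + e)) * (b * b ^ q * (b + fromℕ (2 +ℕ q) * e) + (e - (b + e)) * (b ^ q * (b + fromℕ (suc q) * e)))
        ≈⟨ solve 5 (λ b d e P F →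
             (d :- e) :* (b :* P :* (b :+ (con (+ 1) :+ (con (+ 1) :+ F)) :* e))
               :- (e :- (b :+ e)) :* (b :* P :* (b :+ (con (+ 1) :+ (con (+ 1) :+ F)) :* e)
                                     :+ (e :- (b :+ e)) :* (P :* (b :+ (con (+ 1) :+ F) :* e)))
             := b :* P :* (d :* (b :+ (con (+ 1) :+ (con (+ 1) :+ F)) :* e) :- (con (+ 1) :+ (con (+ 1) :+ F)) :* (e :* e)))
           refl b d e (b ^ q) (fromℕ q) ⟩
      _ ∎

  det-leftPendant : ∀ q → det (sideMatrix 1 q) ≈ (a + e) * det (sideMatrix 0 q) - e * (e * det (uniform q))
  det-leftPendant q = det-sparseFirstRowColumn (sideMatrix 1 q) (λ _ → refl) (λ _ → refl)

  det-leftChain : ∀ p q → det (sideMatrix (suc p) q) ≈ a ^ p * (fromℕ (suc p) * det (sideMatrix 1 q) - (fromℕ p * a) * det (sideMatrix 0 q))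
  det-leftChain p q = repeatedRoot-recurrence (λ p → det (sideMatrix p q)) a step p
    where
    step : ∀ p → det (sideMatrix (2 +ℕ p) q) ≈ (a + a) * det (sideMatrix (suc p) q) - (a * a) * det (sideMatrix p q)
    step p = trans (det-twin (sideMatrix (2 +ℕ p) q) (λ _ → refl) (λ _ → refl))
      (solve 4 (λ a e d₁ d₀ → ((a :+ e) :- e) :* d₁ :- (e :- (a :+ e)) :* (d₁ :+ (e :- (a :+ e)) :* d₀)
                              := (a :+ a) :* d₁ :- (a :* a) :* d₀) refl a e _ _)

<ᵇ-suc : ∀ p i → (p <ᵇ suc i) ≡ (p ≤ᵇ i)
<ᵇ-suc zero    i = ≡.refl
<ᵇ-suc (suc p) i = ≡.refl

inFirst-side : ∀ p i → inFirst (side p i) ≡ (i <ᵇ suc p)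
inFirst-side zero    zero    = ≡.refl
inFirst-side zero    (suc i) = ≡.refl
inFirst-side (suc p) zero    = ≡.refl
inFirst-side (suc p) (suc i) = inFirst-side p i

inSecond-side : ∀ p i → inSecond (side p i) ≡ (p ≤ᵇ i)
inSecond-side zero    zero    = ≡.refl
inSecond-side zero    (suc i) = ≡.refl
inSecond-side (suc p) zero    = ≡.refl
inSecond-side (suc p) (suc i) = ≡.trans (inSecond-side p i) (≡.sym (<ᵇ-suc p i))

adjacency : ℕ → ℕ → ℕ → Bool
adjacency p i j = not (i ≡ᵇ j) ∧ adjacentSides (side p i) (side p j)

KmCircKn≡adjacency : ∀ p q (i j : Fin (p +ℕ suc q)) → KmCircKn (suc p) (suc q) i j ≡ adjacency p (toℕ i) (toℕ j)
KmCircKn≡adjacency p q i j = ≡.cong (not (toℕ i ≡ᵇ toℕ j) ∧_) (≡.sym (≡.cong₂ _∨_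
  (≡.cong₂ _∧_ (inFirst-side p (toℕ i)) (inFirst-side p (toℕ j)))
  (≡.cong₂ _∧_ (inSecond-side p (toℕ i)) (inSecond-side p (toℕ j)))))

sideDegree : Side → ℕ → ℕ → ℕ
sideDegree left  p q = p
sideDegree cut   p q = p +ℕ q
sideDegree right p q = q

module Degree {c ℓ} (R : CommutativeRing c ℓ) where
  open CommutativeRing R
  open WithRing R
  open DeterminantProperties R using (sumFin-cong; sumFin-zero; sumFin-const-1#)

  count-below : ∀ K t → t ≤ K → sumFin {K} (λ j → boolR (toℕ j <ᵇ t)) ≈ fromℕ t
  count-below K       zero    _         = sumFin-zero {K} λ _ → refl
  count-below (suc K) (suc t) (s≤s t≤K) = +-congˡ (count-below K t t≤K)

  count-distinct : ∀ q i → i < q → 1# + sumFin {q} (λ j → boolR (not (i ≡ᵇ toℕ j))) ≈ fromℕ q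
  count-distinct (suc q) zero    _         = +-congˡ (trans (+-identityˡ _) (sumFin-const-1# q))
  count-distinct (suc q) (suc i) (s≤s i<q) = +-congˡ (count-distinct q i i<q)

  degree-step : ∀ s p q → boolR (adjacentSides s left) + fromℕ (sideDegree s p q) ≈ fromℕ (sideDegree s (suc p) q)
  degree-step left  p q = refl
  degree-step cut   p q = refl
  degree-step right p q = +-identityˡ _

  degree-side : ∀ p q i → i < p +ℕ suc q →
    sumFin {p +ℕ suc q} (λ j → boolR (adjacency p i (toℕ j))) ≈ fromℕ (sideDegree (side p i) p q)
  degree-side zero    q zero    _         = trans (+-identityˡ _) (sumFin-const-1# q)
  degree-side zero    q (suc i) (s≤s i<q) = trans
    (+-congˡ (sumFin-cong {q} λ j → reflexive (≡.cong boolR (∧-identityʳ (not (i ≡ᵇ toℕ j))))))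
    (count-distinct q i i<q)
  degree-side (suc p) q zero    _         = trans (+-identityˡ _) (trans
    (sumFin-cong {p +ℕ suc q} λ j → reflexive (≡.cong boolR (≡.trans (∨-identityʳ _) (inFirst-side p (toℕ j)))))
    (count-below (p +ℕ suc q) (suc p) (≡.subst (suc p ≤_) (≡.sym (ℕ.+-suc p q)) (s≤s (ℕ.m≤m+n p q)))))
  degree-side (suc p) q (suc i) (s≤s i<) = trans (+-congˡ (degree-side p q i i<)) (degree-step (side p i) p q)

module KmCircKnMatrix {c ℓ} (R : CommutativeRing c ℓ) (p q : ℕ) (α x : CommutativeRing.Carrier R) where
  open CommutativeRing R
  open WithRing R
  open IntegerCoefficientSolver R using (solve; _:=_; _:+_; _:*_; :-_; _:-_; con; fromℕ-+)
  open DeterminantProperties R using (sumFin-cong; det-cong)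
  open Degree R using (degree-side)

  a b d e : Carrier
  a = (x - α * fromℕ (suc p)) + 1#
  b = (x - α * fromℕ (suc q)) + 1#
  d = x - α * (fromℕ p + fromℕ q)
  e = - (1# - α)

  open SideMatrix R a b d e public

  G : Graph (p +ℕ suc q)
  G = KmCircKn (suc p) (suc q)

  degree≈ : ∀ i → degree G i ≈ fromℕ (sideDegree (side p (toℕ i)) p q)
  degree≈ i = trans (sumFin-cong λ j → reflexive (≡.cong boolR (KmCircKn≡adjacency p q i j)))
    (degree-side p q (toℕ i) (toℕ<n i))

  diagonal≈ : ∀ s δ → δ ≈ fromℕ (sideDegree s p q) → x * 1# - (α * δ + (1# - α) * 0#) ≈ diagonal s
  diagonal≈ left  δ δ≈ = trans (+-congˡ (-‿cong (+-congʳ (*-congˡ δ≈))))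
    (solve 3 (λ x α f → x :* con (+ 1) :- (α :* f :+ (con (+ 1) :- α) :* con (+ 0))
               := ((x :- α :* (con (+ 1) :+ f)) :+ con (+ 1)) :+ (:- (con (+ 1) :- α))) refl x α (fromℕ p))
  diagonal≈ cut   δ δ≈ = trans (+-congˡ (-‿cong (+-congʳ (*-congˡ (trans δ≈ (fromℕ-+ p q))))))
    (solve 3 (λ x α f → x :* con (+ 1) :- (α :* f :+ (con (+ 1) :- α) :* con (+ 0)) := x :- α :* f)
      refl x α (fromℕ p + fromℕ q))
  diagonal≈ right δ δ≈ = trans (+-congˡ (-‿cong (+-congʳ (*-congˡ δ≈))))
    (solve 3 (λ x α f → x :* con (+ 1) :- (α :* f :+ (con (+ 1) :- α) :* con (+ 0))
               := ((x :- α :* (con (+ 1) :+ f)) :+ con (+ 1)) :+ (:- (con (+ 1) :- α))) refl x α (fromℕ q))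

  offDiagonal≈ : ∀ t → x * 0# - (α * 0# + (1# - α) * boolR t) ≈ (if t then e else 0#)
  offDiagonal≈ true  = solve 2 (λ x α → x :* con (+ 0) :- (α :* con (+ 0) :+ (con (+ 1) :- α) :* con (+ 1))
                                        := :- (con (+ 1) :- α)) refl x α
  offDiagonal≈ false = solve 2 (λ x α → x :* con (+ 0) :- (α :* con (+ 0) :+ (con (+ 1) :- α) :* con (+ 0))
                                        := con (+ 0)) refl x α

  entry≈ : ∀ i j δ → δ ≈ fromℕ (sideDegree (side p i) p q) →
    x * (if i ≡ᵇ j then 1# else 0#) - (α * (if i ≡ᵇ j then δ else 0#) + (1# - α) * boolR (adjacency p i j)) ≈ entry p i j
  entry≈ i j δ δ≈ with i ≡ᵇ j
  ... | true  = diagonal≈ (side p i) δ δ≈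
  ... | false = offDiagonal≈ (adjacentSides (side p i) (side p j))

  charMatrix≈sideMatrix : ∀ i j → x * idMat i j - Aα G α i j ≈ sideMatrix p q i j
  charMatrix≈sideMatrix i j = trans
    (+-congˡ (-‿cong (+-congˡ (*-congˡ (reflexive (≡.cong boolR (KmCircKn≡adjacency p q i j)))))))
    (entry≈ (toℕ i) (toℕ j) (degree G i) (degree≈ i))

  Φ≈det-sideMatrix : Φ (Aα G α) x ≈ det (sideMatrix p q)
  Φ≈det-sideMatrix = det-cong charMatrix≈sideMatrix

module KmCircKnPolynomial {c ℓ} (R : CommutativeRing c ℓ) (m′ n′ : ℕ) (α x : CommutativeRing.Carrier R) where
  open CommutativeRing R
  open WithRing R
  open IntegerCoefficientSolver R using (solve; _:=_; _:+_; _:*_; :-_; _:-_; con)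
  open KmCircKnMatrix R (suc m′) (suc n′) α x using (a; b; d; e)

  m n : ℕ
  m = 2 +ℕ m′
  n = 2 +ℕ n′

  closedForm : Carrier → Carrier
  closedForm F = (((x - (α * fromℕ m)) + 1#) ^ (m ∸ 2))
         * ((((x - (α * fromℕ n)) + 1#) ^ (n ∸ 2))
           * ((((x - fromℕ m) + fromℕ 2) - α)
               * ((((x - fromℕ n) + fromℕ 2) - α)
                 * (x - (α * F)))
             - (((1# - α) * (1# - α))
               * ((((F * x) - (F * α))
                   - (fromℕ (m ∸ 1) * fromℕ (n ∸ 2)))
                 - (fromℕ (m ∸ 2) * fromℕ (n ∸ 1))))))

  closedForm-cong : ∀ {F F′} → F ≈ F′ → closedForm F ≈ closedForm F′
  closedForm-cong F≈F′ = *-congˡ (*-congˡ (+-cong (*-congˡ (*-congˡ (+-congˡ (-‿cong (*-congˡ F≈F′)))))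
    (-‿cong (*-congˡ (+-congʳ (+-congʳ (+-cong (*-congʳ F≈F′) (-‿cong (*-congʳ F≈F′)))))))))

  closedForm-expansion : ∀ {G₀ U} →
    G₀ ≈ b ^ n′ * (d * (b + fromℕ (suc n′) * e) - fromℕ (suc n′) * (e * e)) →
    U ≈ b ^ n′ * (b + fromℕ (suc n′) * e) →
    a ^ m′ * (fromℕ (suc m′) * ((a + e) * G₀ - e * (e * U)) - (fromℕ m′ * a) * G₀) ≈ closedForm (fromℕ m′ + fromℕ n)
  closedForm-expansion G₀≈ U≈ = trans
    (*-congˡ (+-cong (*-congˡ (+-cong (*-congˡ G₀≈) (-‿cong (*-congˡ (*-congˡ U≈))))) (-‿cong (*-congˡ G₀≈))))
    (solve 6 (λ x α f g P Q →
      let one = con (+ 1)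
          two = one :+ (one :+ con (+ 0))
          A   = (x :- α :* (one :+ (one :+ f))) :+ one
          B   = (x :- α :* (one :+ (one :+ g))) :+ one
          D   = x :- α :* ((one :+ f) :+ (one :+ g))
          E   = :- (one :- α)
          G₀  = Q :* (D :* (B :+ (one :+ g) :* E) :- (one :+ g) :* (E :* E))
          U   = Q :* (B :+ (one :+ g) :* E)
          F   = f :+ (one :+ (one :+ g))
      in  P :* ((one :+ f) :* ((A :+ E) :* G₀ :- E :* (E :* U)) :- (f :* A) :* G₀)
          := P :* (Q :* ((((x :- (one :+ (one :+ f))) :+ two) :- α) :* ((((x :- (one :+ (one :+ g))) :+ two) :- α) :* (x :- α :* F))
                         :- ((one :- α) :* (one :- α)) :* ((((F :* x) :- (F :* α)) :- ((one :+ f) :* g)) :- (f :* (one :+ g))))))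
      refl x α (fromℕ m′) (fromℕ n′) (a ^ m′) (b ^ n′))

mainTheorem14 : ∀ {c ℓ : Level} (R : CommutativeRing c ℓ) (m n : ℕ) → 2 ≤ m → 2 ≤ n →
  (α x : CommutativeRing.Carrier R) →
  let open CommutativeRing R
      open WithRing R
  in Φ (Aα (KmCircKn m n) α) x
     ≈ (((x - (α * fromℕ m)) + 1#) ^ (m ∸ 2))
       * ((((x - (α * fromℕ n)) + 1#) ^ (n ∸ 2))
         * ((((x - fromℕ m) + fromℕ 2) - α)
             * ((((x - fromℕ n) + fromℕ 2) - α)
               * (x - (α * fromℕ (m +ℕ n ∸ 2))))
           - (((1# - α) * (1# - α))
             * ((((fromℕ (m +ℕ n ∸ 2) * x) - (fromℕ (m +ℕ n ∸ 2) * α))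
                 - (fromℕ (m ∸ 1) * fromℕ (n ∸ 2)))
               - (fromℕ (m ∸ 2) * fromℕ (n ∸ 1))))))
mainTheorem14 R (suc (suc m′)) (suc (suc n′)) (s≤s (s≤s _)) (s≤s (s≤s _)) α x = begin
  _                                        ≈⟨ Φ≈det-sideMatrix ⟩
  det (sideMatrix (suc m′) (suc n′))       ≈⟨ det-leftChain m′ (suc n′) ⟩
  _                                        ≈⟨ *-congˡ (+-congʳ (*-congˡ (det-leftPendant (suc n′)))) ⟩
  _                                        ≈⟨ closedForm-expansion (det-cutThenRight n′) (det-uniform n′) ⟩
  closedForm (fromℕ m′ + fromℕ (2 +ℕ n′)) ≈⟨ closedForm-cong (sym (fromℕ-+ m′ (2 +ℕ n′))) ⟩
  _                                        ∎
  where
  open CommutativeRing R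
  open WithRing R
  open IntegerCoefficientSolver R using (fromℕ-+)
  open KmCircKnMatrix R (suc m′) (suc n′) α x
  open KmCircKnPolynomial R m′ n′ α x
  open import Relation.Binary.Reasoning.Setoid setoid
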